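{- Let $n\ge1$ and let $X$ be a random variable with distribution \[\mathrm{DPP}(q)=\prod_{i=0}^{n-1}\frac{[3i+1]!_q}{[n+i]!_q}\] (the generating function of descending plane partitions of order $n$ by number of boxes). Then $\mathbb{E}(X)=\frac{1}{6}n(n^2-1)$ and $\mathbb{V}(X)=\frac{1}{12}n^2(n^2-1)$.
   Context: $[m]_q=1+\cdots+q^{m-1}$, $[m]!_q=[1]_q\cdots[m]_q$, and "distribution $F$" means $\Pr(X=j)=[q^j]F(q)/F(1)$. -}

module Defs where

open import Data.Nat using (ℕ; zero; suc; _+_; _*_; _^_)
open import Data.List using (List; []; _∷_; replicate; map)

-- Polynomials in q with natural-number coefficients, as coefficient lists
-- (constant term first). Trailing zeros are allowed; equality of
-- polynomials is coefficientwise (see _≈ₚ_).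
Poly : Set
Poly = List ℕ

coeff : Poly → ℕ → ℕ
coeff []       _       = 0
coeff (a ∷ f)  zero    = a
coeff (a ∷ f)  (suc k) = coeff f k

_+ₚ_ : Poly → Poly → Poly
[]      +ₚ g       = g
(a ∷ f) +ₚ []      = a ∷ f
(a ∷ f) +ₚ (b ∷ g) = (a + b) ∷ (f +ₚ g)

_*ₚ_ : Poly → Poly → Poly
[]      *ₚ g = []
(a ∷ f) *ₚ g = map (a *_) g +ₚ (0 ∷ (f *ₚ g))

_≈ₚ_ : Poly → Poly → Set
f ≈ₚ g = ∀ k → coeff f k ≡ coeff g k
  where open import Relation.Binary.PropositionalEquality using (_≡_)

qint : ℕ → Poly
qint m = replicate m 1

qfact : ℕ → Poly
qfact zero    = 1 ∷ []
qfact (suc m) = qfact m *ₚ qint (suc m)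

prodₚ : ℕ → (ℕ → Poly) → Poly
prodₚ zero    f = 1 ∷ []
prodₚ (suc n) f = prodₚ n f *ₚ f n

dppNum : ℕ → Poly
dppNum n = prodₚ n (λ i → qfact (3 * i + 1))

dppDen : ℕ → Poly
dppDen n = prodₚ n (λ i → qfact (n + i))

momentFrom : ℕ → ℕ → Poly → ℕ
momentFrom k j []      = 0
momentFrom k j (a ∷ f) = j ^ k * a + momentFrom k (suc j) f

moment : ℕ → Poly → ℕ
moment k P = momentFrom k 0 P

module Submission where

-- Write m₀, m₁, m₂ for the raw moments Σ_j j^k [q^j]F of a polynomial F.
-- Mean, scaled by 6, and variance, scaled by 12, are encoded without
-- division or subtraction as the relations  Mean a F : 6·m₁ = a·m₀  and
-- Var v F : 12·m₀m₂ = 12·m₁² + v·m₀².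
--
-- 1. Moment calculus: moments respect coefficientwise equality, and the
--    Leibniz rules for m₀, m₁, m₂ of a product show that Mean and Var are
--    additive under multiplication of polynomials and can be cancelled
--    against a factor with m₀ ≠ 0 (means and variances of independent
--    sums add, and subtract for quotients).
-- 2. [m+1]_q (uniform on {0..m}) has Mean 3m and Var m(m+2); hence
--    [m]!_q, and the products dppNum n, dppDen n, have as Mean and Var
--    explicit iterated sums of these.
-- 3. The iterated sums are evaluated in closed form by a telescoping
--    lemma; the Num and Den values differ by n(n²-1) and n²(n²-1), which
--    are the claimed Mean and Var of the quotient P = dppNum n / dppDen n.

open import Defs
open import Data.Nat using (ℕ; zero; suc; _≤_; _+_; _*_; _∸_; _^_; NonZero)
open import Data.Nat.Properties
  using (+-identityʳ; *-zeroʳ; *-assoc; *-distribˡ-+; *-distribʳ-+; +-suc; +-assoc; +-cancelʳ-≡; *-cancelʳ-≡; *-cancelˡ-≡; m*n≢0; m^n≢0)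
open import Data.Nat.Tactic.RingSolver using (solve-∀)
open import Data.List using ([]; _∷_; map)
open import Data.Product using (_×_; _,_)
open import Function using (_∘_)
open import Relation.Binary.PropositionalEquality
  using (_≡_; refl; sym; trans; cong; cong₂; subst; subst₂; module ≡-Reasoning)
open ≡-Reasoning

cancel-via : ∀ {x y} c {e} → x + c ≡ e → y + c ≡ e → x ≡ y
cancel-via {x} {y} c p q = +-cancelʳ-≡ c x y (trans p (sym q))

m0 m1 m2 : Poly → ℕ
m0 = moment 0
m1 = moment 1
m2 = moment 2

momentFrom-resp : ∀ k j f g → f ≈ₚ g → momentFrom k j f ≡ momentFrom k j g
momentFrom-resp k j []      []      e = refl
momentFrom-resp k j []      (b ∷ g) e =
  sym (cong₂ _+_ (trans (cong (j ^ k *_) (sym (e 0))) (*-zeroʳ (j ^ k)))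
                 (sym (momentFrom-resp k (suc j) [] g (e ∘ suc))))
momentFrom-resp k j (a ∷ f) []      e =
  cong₂ _+_ (trans (cong (j ^ k *_) (e 0)) (*-zeroʳ (j ^ k)))
            (momentFrom-resp k (suc j) f [] (e ∘ suc))
momentFrom-resp k j (a ∷ f) (b ∷ g) e =
  cong₂ _+_ (cong (j ^ k *_) (e 0)) (momentFrom-resp k (suc j) f g (e ∘ suc))

momentFrom-+ : ∀ k j f g → momentFrom k j (f +ₚ g) ≡ momentFrom k j f + momentFrom k j g
momentFrom-+ k j []      g       = refl
momentFrom-+ k j (a ∷ f) []      = sym (+-identityʳ _)
momentFrom-+ k j (a ∷ f) (b ∷ g) = begin
  j ^ k * (a + b) + momentFrom k (suc j) (f +ₚ g)
    ≡⟨ cong₂ _+_ (*-distribˡ-+ (j ^ k) a b) (momentFrom-+ k (suc j) f g) ⟩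
  j ^ k * a + j ^ k * b + (momentFrom k (suc j) f + momentFrom k (suc j) g)
    ≡⟨ interchange (j ^ k * a) (j ^ k * b) _ _ ⟩
  j ^ k * a + momentFrom k (suc j) f + (j ^ k * b + momentFrom k (suc j) g) ∎
  where
  interchange : ∀ x y z w → x + y + (z + w) ≡ x + z + (y + w)
  interchange = solve-∀

momentFrom-scale : ∀ k j c g → momentFrom k j (map (c *_) g) ≡ c * momentFrom k j g
momentFrom-scale k j c []      = sym (*-zeroʳ c)
momentFrom-scale k j c (b ∷ g) =
  trans (cong (j ^ k * (c * b) +_) (momentFrom-scale k (suc j) c g))
        (distrib (j ^ k) c b (momentFrom k (suc j) g))
  where
  distrib : ∀ x c b y → x * (c * b) + c * y ≡ c * (x * b + y)
  distrib = solve-∀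

-- Starting the index at j+1 instead of j shifts X to X+1: binomial expansion.
shift0 : ∀ j f → momentFrom 0 (suc j) f ≡ momentFrom 0 j f
shift0 j []      = refl
shift0 j (a ∷ f) = cong (1 * a +_) (shift0 (suc j) f)

shift1 : ∀ j f → momentFrom 1 (suc j) f ≡ momentFrom 1 j f + momentFrom 0 j f
shift1 j []      = refl
shift1 j (a ∷ f) rewrite shift1 (suc j) f =
  expand j a (momentFrom 1 (suc j) f) (momentFrom 0 (suc j) f)
  where
  expand : ∀ j a x y → (suc j * 1) * a + (x + y) ≡ (j * 1) * a + x + (1 * a + y)
  expand = solve-∀

shift2 : ∀ j f → momentFrom 2 (suc j) f ≡ momentFrom 2 j f + 2 * momentFrom 1 j f + momentFrom 0 j f
shift2 j []      = refl
shift2 j (a ∷ f) rewrite shift2 (suc j) f =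
  expand j a (momentFrom 2 (suc j) f) (momentFrom 1 (suc j) f) (momentFrom 0 (suc j) f)
  where
  expand : ∀ j a x y z → (suc j * (suc j * 1)) * a + (x + 2 * y + z)
                       ≡ (j * (j * 1)) * a + x + 2 * ((j * 1) * a + y) + (1 * a + z)
  expand = solve-∀

cons0 : ∀ a f → m0 (a ∷ f) ≡ a + m0 f
cons0 a f = cong₂ _+_ (+-identityʳ a) (shift0 0 f)

cons1 : ∀ a f → m1 (a ∷ f) ≡ m1 f + m0 f
cons1 a f = shift1 0 f

cons2 : ∀ a f → m2 (a ∷ f) ≡ m2 f + 2 * m1 f + m0 f
cons2 a f = shift2 0 f

moment-*-cons : ∀ k a f g → moment k ((a ∷ f) *ₚ g) ≡ a * moment k g + moment k (0 ∷ (f *ₚ g))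
moment-*-cons k a f g =
  trans (momentFrom-+ k 0 (map (a *_) g) (0 ∷ (f *ₚ g)))
        (cong (_+ moment k (0 ∷ (f *ₚ g))) (momentFrom-scale k 0 a g))

mul0 : ∀ f g → m0 (f *ₚ g) ≡ m0 f * m0 g
mul0 []      g = refl
mul0 (a ∷ f) g = begin
  m0 ((a ∷ f) *ₚ g)            ≡⟨ moment-*-cons 0 a f g ⟩
  a * m0 g + m0 (0 ∷ (f *ₚ g)) ≡⟨ cong (a * m0 g +_) (trans (cons0 0 (f *ₚ g)) (mul0 f g)) ⟩
  a * m0 g + m0 f * m0 g       ≡⟨ sym (*-distribʳ-+ (m0 g) a (m0 f)) ⟩
  (a + m0 f) * m0 g            ≡⟨ cong (_* m0 g) (sym (cons0 a f)) ⟩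
  m0 (a ∷ f) * m0 g            ∎

mul1 : ∀ f g → m1 (f *ₚ g) ≡ m1 f * m0 g + m0 f * m1 g
mul1 []      g = refl
mul1 (a ∷ f) g = begin
  m1 ((a ∷ f) *ₚ g)                                    ≡⟨ moment-*-cons 1 a f g ⟩
  a * m1 g + m1 (0 ∷ (f *ₚ g))                         ≡⟨ cong (a * m1 g +_) (cons1 0 (f *ₚ g)) ⟩
  a * m1 g + (m1 (f *ₚ g) + m0 (f *ₚ g))               ≡⟨ cong₂ (λ x y → a * m1 g + (x + y)) (mul1 f g) (mul0 f g) ⟩
  a * m1 g + (m1 f * m0 g + m0 f * m1 g + m0 f * m0 g) ≡⟨ regroup a (m1 g) (m0 g) (m1 f) (m0 f) ⟩
  (m1 f + m0 f) * m0 g + (a + m0 f) * m1 g             ≡⟨ sym (cong₂ (λ x y → x * m0 g + y * m1 g) (cons1 a f) (cons0 a f)) ⟩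
  m1 (a ∷ f) * m0 g + m0 (a ∷ f) * m1 g                ∎
  where
  regroup : ∀ a g1 g0 f1 f0 → a * g1 + (f1 * g0 + f0 * g1 + f0 * g0) ≡ (f1 + f0) * g0 + (a + f0) * g1
  regroup = solve-∀

mul2 : ∀ f g → m2 (f *ₚ g) ≡ m2 f * m0 g + 2 * (m1 f * m1 g) + m0 f * m2 g
mul2 []      g = refl
mul2 (a ∷ f) g = begin
  m2 ((a ∷ f) *ₚ g)
    ≡⟨ moment-*-cons 2 a f g ⟩
  a * m2 g + m2 (0 ∷ (f *ₚ g))
    ≡⟨ cong (a * m2 g +_) (cons2 0 (f *ₚ g)) ⟩
  a * m2 g + (m2 (f *ₚ g) + 2 * m1 (f *ₚ g) + m0 (f *ₚ g))
    ≡⟨ cong₃ (λ x y z → a * m2 g + (x + 2 * y + z)) (mul2 f g) (mul1 f g) (mul0 f g) ⟩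
  a * m2 g + ((f2 * g0 + 2 * (f1 * g1) + f0 * g2) + 2 * (f1 * g0 + f0 * g1) + f0 * g0)
    ≡⟨ regroup a g2 g1 g0 f2 f1 f0 ⟩
  (f2 + 2 * f1 + f0) * g0 + 2 * ((f1 + f0) * g1) + (a + f0) * g2
    ≡⟨ sym (cong₃ (λ x y z → x * g0 + 2 * (y * g1) + z * g2) (cons2 a f) (cons1 a f) (cons0 a f)) ⟩
  m2 (a ∷ f) * g0 + 2 * (m1 (a ∷ f) * g1) + m0 (a ∷ f) * g2 ∎
  where
  f0 = m0 f
  f1 = m1 f
  f2 = m2 f
  g0 = m0 g
  g1 = m1 g
  g2 = m2 g
  cong₃ : ∀ (h : ℕ → ℕ → ℕ → ℕ) {x x′ y y′ z z′} → x ≡ x′ → y ≡ y′ → z ≡ z′ → h x y z ≡ h x′ y′ z′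
  cong₃ h refl refl refl = refl
  regroup : ∀ a g2 g1 g0 f2 f1 f0 →
    a * g2 + ((f2 * g0 + 2 * (f1 * g1) + f0 * g2) + 2 * (f1 * g0 + f0 * g1) + f0 * g0)
      ≡ (f2 + 2 * f1 + f0) * g0 + 2 * ((f1 + f0) * g1) + (a + f0) * g2
  regroup = solve-∀

-- The Leibniz rules, in the combinations that enter the variance.  (The
-- ring solver does not handle _^_ on ℕ, so solver identities below spell
-- x ^ 2 as its unfolding x * (x * 1).)
-- cross f g is the covariance-type term that appears in both.
cross : Poly → Poly → ℕ
cross f g = 24 * (m0 f * m1 f * (m0 g * m1 g))

mass-sq-product : ∀ f g → m0 (f *ₚ g) ^ 2 ≡ m0 f ^ 2 * m0 g ^ 2
mass-sq-product f g = trans (cong (_^ 2) (mul0 f g)) (square-product (m0 f) (m0 g))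
  where
  square-product : ∀ x y → (x * y) * ((x * y) * 1) ≡ x * (x * 1) * (y * (y * 1))
  square-product = solve-∀

first-sq-product : ∀ f g →
  12 * m1 (f *ₚ g) ^ 2 ≡ m0 g ^ 2 * (12 * m1 f ^ 2) + m0 f ^ 2 * (12 * m1 g ^ 2) + cross f g
first-sq-product f g =
  trans (cong (λ x → 12 * x ^ 2) (mul1 f g)) (expand (m0 f) (m1 f) (m0 g) (m1 g))
  where
  expand : ∀ f0 f1 g0 g1 → 12 * ((f1 * g0 + f0 * g1) * ((f1 * g0 + f0 * g1) * 1))
    ≡ g0 * (g0 * 1) * (12 * (f1 * (f1 * 1))) + f0 * (f0 * 1) * (12 * (g1 * (g1 * 1))) + 24 * (f0 * f1 * (g0 * g1))
  expand = solve-∀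

second-product : ∀ f g →
  12 * (m0 (f *ₚ g) * m2 (f *ₚ g))
    ≡ m0 g ^ 2 * (12 * (m0 f * m2 f)) + m0 f ^ 2 * (12 * (m0 g * m2 g)) + cross f g
second-product f g =
  trans (cong₂ (λ x y → 12 * (x * y)) (mul0 f g) (mul2 f g))
        (expand (m0 f) (m1 f) (m2 f) (m0 g) (m1 g) (m2 g))
  where
  expand : ∀ f0 f1 f2 g0 g1 g2 → 12 * (f0 * g0 * (f2 * g0 + 2 * (f1 * g1) + f0 * g2))
    ≡ g0 * (g0 * 1) * (12 * (f0 * f2)) + f0 * (f0 * 1) * (12 * (g0 * g2)) + 24 * (f0 * f1 * (g0 * g1))
  expand = solve-∀

-- Mean a F: the distribution F has mean a/6.
Mean : ℕ → Poly → Set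
Mean a F = 6 * m1 F ≡ a * m0 F

-- Var v F: the distribution F has variance v/12.
Var : ℕ → Poly → Set
Var v F = 12 * (m0 F * m2 F) ≡ 12 * (m1 F ^ 2) + v * (m0 F ^ 2)

mean-resp : ∀ a F G → F ≈ₚ G → Mean a F → Mean a G
mean-resp a F G e h =
  subst₂ (λ x y → 6 * x ≡ a * y) (momentFrom-resp 1 0 F G e) (momentFrom-resp 0 0 F G e) h

var-resp : ∀ v F G → F ≈ₚ G → Var v F → Var v G
var-resp v F G e h =
  subst₃ (λ x y z → 12 * (x * z) ≡ 12 * (y ^ 2) + v * (x ^ 2))
         (momentFrom-resp 0 0 F G e) (momentFrom-resp 1 0 F G e) (momentFrom-resp 2 0 F G e) h
  where
  subst₃ : ∀ (R : ℕ → ℕ → ℕ → Set) {x x′ y y′ z z′} → x ≡ x′ → y ≡ y′ → z ≡ z′ → R x y z → R x′ y′ z′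
  subst₃ R refl refl refl r = r

mean-mul : ∀ a b f g → Mean a f → Mean b g → Mean (a + b) (f *ₚ g)
mean-mul a b f g hf hg = begin
  6 * m1 (f *ₚ g)                       ≡⟨ cong (6 *_) (mul1 f g) ⟩
  6 * (m1 f * m0 g + m0 f * m1 g)       ≡⟨ distrib (m1 f) (m0 g) (m0 f) (m1 g) ⟩
  6 * m1 f * m0 g + m0 f * (6 * m1 g)   ≡⟨ cong₂ (λ x y → x * m0 g + m0 f * y) hf hg ⟩
  a * m0 f * m0 g + m0 f * (b * m0 g)   ≡⟨ collect a b (m0 f) (m0 g) ⟩
  (a + b) * (m0 f * m0 g)               ≡⟨ cong ((a + b) *_) (sym (mul0 f g)) ⟩
  (a + b) * m0 (f *ₚ g)                 ∎
  where
  distrib : ∀ f1 g0 f0 g1 → 6 * (f1 * g0 + f0 * g1) ≡ 6 * f1 * g0 + f0 * (6 * g1)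
  distrib = solve-∀
  collect : ∀ a b f0 g0 → a * f0 * g0 + f0 * (b * g0) ≡ (a + b) * (f0 * g0)
  collect = solve-∀

var-mul : ∀ v w f g → Var v f → Var w g → Var (v + w) (f *ₚ g)
var-mul v w f g hf hg = begin
  12 * (m0 (f *ₚ g) * m2 (f *ₚ g))
    ≡⟨ second-product f g ⟩
  g0 ^ 2 * (12 * (f0 * m2 f)) + f0 ^ 2 * (12 * (g0 * m2 g)) + cross f g
    ≡⟨ cong₂ (λ x y → g0 ^ 2 * x + f0 ^ 2 * y + cross f g) hf hg ⟩
  g0 ^ 2 * (12 * f1 ^ 2 + v * f0 ^ 2) + f0 ^ 2 * (12 * g1 ^ 2 + w * g0 ^ 2) + cross f g
    ≡⟨ regroup f0 f1 g0 g1 v w (cross f g) ⟩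
  (g0 ^ 2 * (12 * f1 ^ 2) + f0 ^ 2 * (12 * g1 ^ 2) + cross f g) + (v + w) * (f0 ^ 2 * g0 ^ 2)
    ≡⟨ cong₂ (λ x y → x + (v + w) * y) (sym (first-sq-product f g)) (sym (mass-sq-product f g)) ⟩
  12 * m1 (f *ₚ g) ^ 2 + (v + w) * m0 (f *ₚ g) ^ 2 ∎
  where
  f0 = m0 f
  f1 = m1 f
  g0 = m0 g
  g1 = m1 g
  regroup : ∀ f0 f1 g0 g1 v w c →
    g0 * (g0 * 1) * (12 * (f1 * (f1 * 1)) + v * (f0 * (f0 * 1))) + f0 * (f0 * 1) * (12 * (g1 * (g1 * 1)) + w * (g0 * (g0 * 1))) + c
      ≡ (g0 * (g0 * 1) * (12 * (f1 * (f1 * 1))) + f0 * (f0 * 1) * (12 * (g1 * (g1 * 1))) + c) + (v + w) * (f0 * (f0 * 1) * (g0 * (g0 * 1)))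
  regroup = solve-∀

mean-cancel : ∀ a c P D .{{_ : NonZero (m0 D)}} → Mean a D → Mean (c + a) (P *ₚ D) → Mean c P
mean-cancel a c P D hD hPD = *-cancelʳ-≡ (6 * p1) (c * p0) d0 (cancel-via (p0 * (a * d0)) viaProduct collect)
  where
  p0 = m0 P
  p1 = m1 P
  d0 = m0 D
  d1 = m1 D
  viaProduct : 6 * p1 * d0 + p0 * (a * d0) ≡ (c + a) * (p0 * d0)
  viaProduct = begin
    6 * p1 * d0 + p0 * (a * d0)   ≡⟨ cong (λ x → 6 * p1 * d0 + p0 * x) (sym hD) ⟩
    6 * p1 * d0 + p0 * (6 * d1)   ≡⟨ distrib p1 d0 p0 d1 ⟩
    6 * (p1 * d0 + p0 * d1)       ≡⟨ cong (6 *_) (sym (mul1 P D)) ⟩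
    6 * m1 (P *ₚ D)               ≡⟨ hPD ⟩
    (c + a) * m0 (P *ₚ D)         ≡⟨ cong ((c + a) *_) (mul0 P D) ⟩
    (c + a) * (p0 * d0)           ∎
    where
    distrib : ∀ p1 d0 p0 d1 → 6 * p1 * d0 + p0 * (6 * d1) ≡ 6 * (p1 * d0 + p0 * d1)
    distrib = solve-∀
  collect : c * p0 * d0 + p0 * (a * d0) ≡ (c + a) * (p0 * d0)
  collect = identity c p0 d0 a
    where
    identity : ∀ c p0 d0 a → c * p0 * d0 + p0 * (a * d0) ≡ (c + a) * (p0 * d0)
    identity = solve-∀

-- Both sides of  Var (w + v) (P *ₚ D), expanded by the Leibniz rules, are
-- d0² · (the two sides of Var w P) plus a common remainder.
var-cancel : ∀ v w P D .{{_ : NonZero (m0 D)}} → Var v D → Var (w + v) (P *ₚ D) → Var w P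
var-cancel v w P D hD hPD =
  *-cancelˡ-≡ (12 * (p0 * m2 P)) (12 * p1 ^ 2 + w * p0 ^ 2) (d0 ^ 2) {{m^n≢0 d0 2}} (cancel-via remainder viaProduct viaSquares)
  where
  p0 = m0 P
  p1 = m1 P
  d0 = m0 D
  d1 = m1 D
  remainder : ℕ
  remainder = p0 ^ 2 * (12 * d1 ^ 2 + v * d0 ^ 2) + cross P D
  target : ℕ
  target = 12 * m1 (P *ₚ D) ^ 2 + (w + v) * m0 (P *ₚ D) ^ 2
  viaProduct : d0 ^ 2 * (12 * (p0 * m2 P)) + remainder ≡ target
  viaProduct = begin
    d0 ^ 2 * (12 * (p0 * m2 P)) + (p0 ^ 2 * (12 * d1 ^ 2 + v * d0 ^ 2) + cross P D)
      ≡⟨ cong (λ x → d0 ^ 2 * (12 * (p0 * m2 P)) + (p0 ^ 2 * x + cross P D)) (sym hD) ⟩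
    d0 ^ 2 * (12 * (p0 * m2 P)) + (p0 ^ 2 * (12 * (d0 * m2 D)) + cross P D)
      ≡⟨ sym (+-assoc (d0 ^ 2 * (12 * (p0 * m2 P))) (p0 ^ 2 * (12 * (d0 * m2 D))) (cross P D)) ⟩
    d0 ^ 2 * (12 * (p0 * m2 P)) + p0 ^ 2 * (12 * (d0 * m2 D)) + cross P D
      ≡⟨ sym (second-product P D) ⟩
    12 * (m0 (P *ₚ D) * m2 (P *ₚ D))
      ≡⟨ hPD ⟩
    target ∎
  viaSquares : d0 ^ 2 * (12 * p1 ^ 2 + w * p0 ^ 2) + remainder ≡ target
  viaSquares = begin
    d0 ^ 2 * (12 * p1 ^ 2 + w * p0 ^ 2) + (p0 ^ 2 * (12 * d1 ^ 2 + v * d0 ^ 2) + cross P D)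
      ≡⟨ regroup p0 p1 d0 d1 v w (cross P D) ⟩
    (d0 ^ 2 * (12 * p1 ^ 2) + p0 ^ 2 * (12 * d1 ^ 2) + cross P D) + (w + v) * (p0 ^ 2 * d0 ^ 2)
      ≡⟨ cong₂ (λ x y → x + (w + v) * y) (sym (first-sq-product P D)) (sym (mass-sq-product P D)) ⟩
    target ∎
    where
    regroup : ∀ p0 p1 d0 d1 v w c →
      d0 * (d0 * 1) * (12 * (p1 * (p1 * 1)) + w * (p0 * (p0 * 1))) + (p0 * (p0 * 1) * (12 * (d1 * (d1 * 1)) + v * (d0 * (d0 * 1))) + c)
        ≡ (d0 * (d0 * 1) * (12 * (p1 * (p1 * 1))) + p0 * (p0 * 1) * (12 * (d1 * (d1 * 1))) + c) + (w + v) * (p0 * (p0 * 1) * (d0 * (d0 * 1)))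
    regroup = solve-∀

sumTo : ℕ → (ℕ → ℕ) → ℕ
sumTo zero    f = 0
sumTo (suc n) f = sumTo n f + f n

mean-prod : ∀ n (a : ℕ → ℕ) (F : ℕ → Poly) → (∀ i → Mean (a i) (F i)) → Mean (sumTo n a) (prodₚ n F)
mean-prod zero    a F h = refl
mean-prod (suc n) a F h = mean-mul (sumTo n a) (a n) (prodₚ n F) (F n) (mean-prod n a F h) (h n)

var-prod : ∀ n (v : ℕ → ℕ) (F : ℕ → Poly) → (∀ i → Var (v i) (F i)) → Var (sumTo n v) (prodₚ n F)
var-prod zero    v F h = refl
var-prod (suc n) v F h = var-mul (sumTo n v) (v n) (prodₚ n F) (F n) (var-prod n v F h) (h n)

prod-nonzero : ∀ n (F : ℕ → Poly) → (∀ i → NonZero (m0 (F i))) → NonZero (m0 (prodₚ n F))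
prod-nonzero zero    F h = _
prod-nonzero (suc n) F h =
  subst NonZero (sym (mul0 (prodₚ n F) (F n))) (m*n≢0 _ _ {{prod-nonzero n F h}} {{h n}})

qint-m0 : ∀ m → m0 (qint m) ≡ m
qint-m0 zero    = refl
qint-m0 (suc m) = trans (cons0 1 (qint m)) (cong suc (qint-m0 m))

qint-m1 : ∀ m → 2 * m1 (qint (suc m)) ≡ m * suc m
qint-m1 zero    = refl
qint-m1 (suc m) = begin
  2 * m1 (1 ∷ qint (suc m))                    ≡⟨ cong (2 *_) (cons1 1 (qint (suc m))) ⟩
  2 * (m1 (qint (suc m)) + m0 (qint (suc m)))  ≡⟨ cong (λ x → 2 * (m1 (qint (suc m)) + x)) (qint-m0 (suc m)) ⟩
  2 * (m1 (qint (suc m)) + suc m)              ≡⟨ split (m1 (qint (suc m))) m ⟩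
  2 * m1 (qint (suc m)) + 2 * suc m            ≡⟨ cong (_+ 2 * suc m) (qint-m1 m) ⟩
  m * suc m + 2 * suc m                        ≡⟨ collect m ⟩
  suc m * suc (suc m)                          ∎
  where
  split : ∀ x m → 2 * (x + suc m) ≡ 2 * x + 2 * suc m
  split = solve-∀
  collect : ∀ m → m * suc m + 2 * suc m ≡ suc m * suc (suc m)
  collect = solve-∀

qint-m2 : ∀ m → 6 * m2 (qint (suc m)) ≡ m * suc m * (2 * m + 1)
qint-m2 zero    = refl
qint-m2 (suc m) = begin
  6 * m2 (1 ∷ qint (suc m))        ≡⟨ cong (6 *_) (cons2 1 (qint (suc m))) ⟩
  6 * (y + 2 * x + m0 (qint (suc m))) ≡⟨ cong (λ z → 6 * (y + 2 * x + z)) (qint-m0 (suc m)) ⟩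
  6 * (y + 2 * x + suc m)          ≡⟨ split y x m ⟩
  6 * y + 6 * (2 * x) + 6 * suc m  ≡⟨ cong₂ (λ s t → s + 6 * t + 6 * suc m) (qint-m2 m) (qint-m1 m) ⟩
  m * suc m * (2 * m + 1) + 6 * (m * suc m) + 6 * suc m ≡⟨ collect m ⟩
  suc m * suc (suc m) * (2 * suc m + 1) ∎
  where
  x = m1 (qint (suc m))
  y = m2 (qint (suc m))
  split : ∀ y x m → 6 * (y + 2 * x + suc m) ≡ 6 * y + 6 * (2 * x) + 6 * suc m
  split = solve-∀
  collect : ∀ m → m * suc m * (2 * m + 1) + 6 * (m * suc m) + 6 * suc m ≡ suc m * suc (suc m) * (2 * suc m + 1)
  collect = solve-∀

mean-qint : ∀ m → Mean (3 * m) (qint (suc m))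
mean-qint m = begin
  6 * m1 (qint (suc m))       ≡⟨ *-assoc 3 2 (m1 (qint (suc m))) ⟩
  3 * (2 * m1 (qint (suc m))) ≡⟨ cong (3 *_) (qint-m1 m) ⟩
  3 * (m * suc m)             ≡⟨ sym (*-assoc 3 m (suc m)) ⟩
  3 * m * suc m               ≡⟨ cong (3 * m *_) (sym (qint-m0 (suc m))) ⟩
  3 * m * m0 (qint (suc m))   ∎

var-qint : ∀ m → Var (m * (m + 2)) (qint (suc m))
var-qint m = begin
  12 * (m0 (qint (suc m)) * y)           ≡⟨ cong (λ z → 12 * (z * y)) (qint-m0 (suc m)) ⟩
  12 * (suc m * y)                       ≡⟨ factor m y ⟩
  2 * suc m * (6 * y)                    ≡⟨ cong (2 * suc m *_) (qint-m2 m) ⟩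
  2 * suc m * (m * suc m * (2 * m + 1))  ≡⟨ evaluate m ⟩
  3 * ((m * suc m) * ((m * suc m) * 1)) + m * (m + 2) * (suc m * (suc m * 1))
    ≡⟨ cong₂ (λ s t → 3 * (s * (s * 1)) + m * (m + 2) * (t * (t * 1))) (sym (qint-m1 m)) (sym (qint-m0 (suc m))) ⟩
  3 * ((2 * x) * ((2 * x) * 1)) + m * (m + 2) * m0 (qint (suc m)) ^ 2
    ≡⟨ cong (_+ m * (m + 2) * m0 (qint (suc m)) ^ 2) (square-double x) ⟩
  12 * x ^ 2 + m * (m + 2) * m0 (qint (suc m)) ^ 2 ∎
  where
  x = m1 (qint (suc m))
  y = m2 (qint (suc m))
  factor : ∀ m y → 12 * (suc m * y) ≡ 2 * suc m * (6 * y)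
  factor = solve-∀
  evaluate : ∀ m → 2 * suc m * (m * suc m * (2 * m + 1))
    ≡ 3 * ((m * suc m) * ((m * suc m) * 1)) + m * (m + 2) * (suc m * (suc m * 1))
  evaluate = solve-∀
  square-double : ∀ x → 3 * ((2 * x) * ((2 * x) * 1)) ≡ 12 * (x * (x * 1))
  square-double = solve-∀

qfact-prod : ∀ m → qfact m ≡ prodₚ m (λ i → qint (suc i))
qfact-prod zero    = refl
qfact-prod (suc m) = cong (_*ₚ qint (suc m)) (qfact-prod m)

-- 6 × mean and 12 × variance of [m]!_q.
factMean factVar : ℕ → ℕ
factMean m = sumTo m (λ i → 3 * i)
factVar  m = sumTo m (λ i → i * (i + 2))

mean-qfacts : ∀ n (g : ℕ → ℕ) → Mean (sumTo n (factMean ∘ g)) (prodₚ n (qfact ∘ g))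
mean-qfacts n g = mean-prod n (factMean ∘ g) (qfact ∘ g) λ i →
  subst (Mean (factMean (g i))) (sym (qfact-prod (g i))) (mean-prod (g i) (3 *_) (qint ∘ suc) mean-qint)

var-qfacts : ∀ n (g : ℕ → ℕ) → Var (sumTo n (factVar ∘ g)) (prodₚ n (qfact ∘ g))
var-qfacts n g = var-prod n (factVar ∘ g) (qfact ∘ g) λ i →
  subst (Var (factVar (g i))) (sym (qfact-prod (g i))) (var-prod (g i) (λ j → j * (j + 2)) (qint ∘ suc) var-qint)

-- m0 [i+1]_q = i + 1 reduces to a successor, so NonZero holds by computation.
qfacts-nonzero : ∀ n (g : ℕ → ℕ) → NonZero (m0 (prodₚ n (qfact ∘ g)))
qfacts-nonzero n g = prod-nonzero n (qfact ∘ g) λ i →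
  subst (NonZero ∘ m0) (sym (qfact-prod (g i))) (prod-nonzero (g i) (qint ∘ suc) (λ _ → _))

-- Telescoping, with natural-number offsets in place of subtraction: if each
-- term satisfies K·f n + A n = B n and the candidate closed form P, Q
-- satisfies the step identity below, then K·Σ_{i<n} f i + P n = Q n.
telescope : ∀ K (f A B P Q : ℕ → ℕ) → (∀ n → K * f n + A n ≡ B n) → P 0 ≡ Q 0 →
  (∀ n → Q n + B n + P (suc n) ≡ Q (suc n) + (P n + A n)) →
  ∀ n → K * sumTo n f + P n ≡ Q n
telescope K f A B P Q term base step zero    = trans (cong (_+ P 0) (*-zeroʳ K)) base
telescope K f A B P Q term base step (suc n) = cancel-via (P n + A n) (begin
  K * (sumTo n f + f n) + P (suc n) + (P n + A n)
    ≡⟨ regroup K (sumTo n f) (f n) (P (suc n)) (P n) (A n) ⟩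
  (K * sumTo n f + P n) + (K * f n + A n) + P (suc n)
    ≡⟨ cong₂ (λ x y → x + y + P (suc n)) (telescope K f A B P Q term base step n) (term n) ⟩
  Q n + B n + P (suc n) ∎) (sym (step n))
  where
  regroup : ∀ K s t p′ p a → K * (s + t) + p′ + (p + a) ≡ (K * s + p) + (K * t + a) + p′
  regroup = solve-∀

sum-split : ∀ f m k → sumTo m f + sumTo k (λ i → f (m + i)) ≡ sumTo (m + k) f
sum-split f m zero    = trans (+-identityʳ _) (cong (λ z → sumTo z f) (sym (+-identityʳ m)))
sum-split f m (suc k) = begin
  sumTo m f + (sumTo k (λ i → f (m + i)) + f (m + k)) ≡⟨ sym (+-assoc (sumTo m f) _ (f (m + k))) ⟩
  sumTo m f + sumTo k (λ i → f (m + i)) + f (m + k)   ≡⟨ cong (_+ f (m + k)) (sum-split f m k) ⟩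
  sumTo (suc (m + k)) f                               ≡⟨ cong (λ z → sumTo z f) (sym (+-suc m k)) ⟩
  sumTo (m + suc k) f                                 ∎

window-closed : ∀ K f (P Q : ℕ → ℕ) → (∀ m → K * sumTo m f + P m ≡ Q m) →
  ∀ n → K * sumTo n (λ i → f (n + i)) + P (n + n) + Q n ≡ Q (n + n) + P n
window-closed K f P Q closed n = begin
  K * w + P (n + n) + Q n                   ≡⟨ cong (K * w + P (n + n) +_) (sym (closed n)) ⟩
  K * w + P (n + n) + (K * sumTo n f + P n) ≡⟨ regroup K w (P (n + n)) (sumTo n f) (P n) ⟩
  K * (sumTo n f + w) + P (n + n) + P n     ≡⟨ cong (λ s → K * s + P (n + n) + P n) (sum-split f n n) ⟩
  K * sumTo (n + n) f + P (n + n) + P n     ≡⟨ cong (_+ P n) (closed (n + n)) ⟩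
  Q (n + n) + P n                           ∎
  where
  w = sumTo n (λ i → f (n + i))
  regroup : ∀ K w p′ s p → K * w + p′ + (K * s + p) ≡ K * (s + w) + p′ + p
  regroup = solve-∀

factMean-closed : ∀ m → 2 * factMean m + 3 * m ≡ 3 * (m * m)
factMean-closed = telescope 2 (3 *_) (λ _ → 0) (6 *_) (3 *_) (λ m → 3 * (m * m)) solve-∀ refl solve-∀

factMean-sum-closed : ∀ m → 2 * sumTo m factMean + 3 * (m * m) ≡ m * m * m + 2 * m
factMean-sum-closed = telescope 2 factMean (3 *_) (λ m → 3 * (m * m)) (λ m → 3 * (m * m))
  (λ m → m * m * m + 2 * m) factMean-closed refl solve-∀

factVar-closed : ∀ m → 12 * factVar m + 10 * m ≡ 4 * (m * m * m) + 6 * (m * m)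
factVar-closed = telescope 12 (λ i → i * (i + 2)) (λ _ → 0) (λ i → 12 * (i * (i + 2))) (10 *_)
  (λ m → 4 * (m * m * m) + 6 * (m * m)) solve-∀ refl solve-∀

factVar-sum-closed : ∀ m → 12 * sumTo m factVar + 7 * (m * m) ≡ m * m * m * m + 6 * m
factVar-sum-closed = telescope 12 factVar (10 *_) (λ m → 4 * (m * m * m) + 6 * (m * m)) (λ m → 7 * (m * m))
  (λ m → m * m * m * m + 6 * m) factVar-closed refl solve-∀

numIndex : ℕ → ℕ
numIndex i = 3 * i + 1

numMean numVar denMean denVar : ℕ → ℕ
numMean n = sumTo n (factMean ∘ numIndex)
numVar  n = sumTo n (factVar ∘ numIndex)
denMean n = sumTo n (factMean ∘ (n +_))
denVar  n = sumTo n (factVar ∘ (n +_))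

numMean-closed : ∀ n → 2 * numMean n + 9 * (n * n) ≡ 9 * (n * n * n)
numMean-closed = telescope 2 (factMean ∘ numIndex) (λ i → 3 * (3 * i + 1))
  (λ i → 3 * ((3 * i + 1) * (3 * i + 1))) (λ n → 9 * (n * n)) (λ n → 9 * (n * n * n))
  (factMean-closed ∘ numIndex) refl solve-∀

numVar-closed : ∀ n → 12 * numVar n + 33 * (n * n) ≡ 27 * (n * n * n * n) + 6 * n
numVar-closed = telescope 12 (factVar ∘ numIndex) (λ i → 10 * (3 * i + 1))
  (λ i → 4 * ((3 * i + 1) * (3 * i + 1) * (3 * i + 1)) + 6 * ((3 * i + 1) * (3 * i + 1)))
  (λ n → 33 * (n * n)) (λ n → 27 * (n * n * n * n) + 6 * n)
  (factVar-closed ∘ numIndex) refl solve-∀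

-- The mean of the numerator exceeds that of the denominator by n(n²-1)
-- (scaled by 6): 2·(numMean n + n) and 2·(denMean n + n³) agree after
-- adding the same offset, by the closed forms of numMean and of the window
-- sum denMean.
mean-gap : ∀ n → numMean n + n ≡ denMean n + n * n * n
mean-gap n = *-cancelˡ-≡ (numMean n + n) (denMean n + n * n * n) 2
  (cancel-via (3 * ((n + n) * (n + n)) + (n * n * n + 2 * n)) viaNum viaDen)
  where
  viaNum : 2 * (numMean n + n) + (3 * ((n + n) * (n + n)) + (n * n * n + 2 * n))
         ≡ (n + n) * (n + n) * (n + n) + 2 * (n + n) + 3 * (n * n) + 2 * (n * n * n)
  viaNum = trans (regroup (numMean n) n)
    (trans (cong (_+ (3 * (n * n) + (n * n * n + 4 * n))) (numMean-closed n)) (evaluate n))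
    where
    regroup : ∀ t n → 2 * (t + n) + (3 * ((n + n) * (n + n)) + (n * n * n + 2 * n))
                    ≡ 2 * t + 9 * (n * n) + (3 * (n * n) + (n * n * n + 4 * n))
    regroup = solve-∀
    evaluate : ∀ n → 9 * (n * n * n) + (3 * (n * n) + (n * n * n + 4 * n))
                   ≡ (n + n) * (n + n) * (n + n) + 2 * (n + n) + 3 * (n * n) + 2 * (n * n * n)
    evaluate = solve-∀
  viaDen : 2 * (denMean n + n * n * n) + (3 * ((n + n) * (n + n)) + (n * n * n + 2 * n))
         ≡ (n + n) * (n + n) * (n + n) + 2 * (n + n) + 3 * (n * n) + 2 * (n * n * n)
  viaDen = trans (regroup (denMean n) n) (cong (_+ 2 * (n * n * n))
    (window-closed 2 factMean (λ m → 3 * (m * m)) (λ m → m * m * m + 2 * m) factMean-sum-closed n))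
    where
    regroup : ∀ d n → 2 * (d + n * n * n) + (3 * ((n + n) * (n + n)) + (n * n * n + 2 * n))
                    ≡ 2 * d + 3 * ((n + n) * (n + n)) + (n * n * n + 2 * n) + 2 * (n * n * n)
    regroup = solve-∀

var-gap : ∀ n → numVar n + n * n ≡ denVar n + n * n * n * n
var-gap n = *-cancelˡ-≡ (numVar n + n * n) (denVar n + n * n * n * n) 12
  (cancel-via (7 * ((n + n) * (n + n)) + (n * n * n * n + 6 * n)) viaNum viaDen)
  where
  viaNum : 12 * (numVar n + n * n) + (7 * ((n + n) * (n + n)) + (n * n * n * n + 6 * n))
         ≡ (n + n) * (n + n) * (n + n) * (n + n) + 6 * (n + n) + 7 * (n * n) + 12 * (n * n * n * n)
  viaNum = trans (regroup (numVar n) n)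
    (trans (cong (_+ (7 * (n * n) + (n * n * n * n + 6 * n))) (numVar-closed n)) (evaluate n))
    where
    regroup : ∀ u n → 12 * (u + n * n) + (7 * ((n + n) * (n + n)) + (n * n * n * n + 6 * n))
                    ≡ 12 * u + 33 * (n * n) + (7 * (n * n) + (n * n * n * n + 6 * n))
    regroup = solve-∀
    evaluate : ∀ n → 27 * (n * n * n * n) + 6 * n + (7 * (n * n) + (n * n * n * n + 6 * n))
                   ≡ (n + n) * (n + n) * (n + n) * (n + n) + 6 * (n + n) + 7 * (n * n) + 12 * (n * n * n * n)
    evaluate = solve-∀
  viaDen : 12 * (denVar n + n * n * n * n) + (7 * ((n + n) * (n + n)) + (n * n * n * n + 6 * n))
         ≡ (n + n) * (n + n) * (n + n) * (n + n) + 6 * (n + n) + 7 * (n * n) + 12 * (n * n * n * n)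
  viaDen = trans (regroup (denVar n) n) (cong (_+ 12 * (n * n * n * n))
    (window-closed 12 factVar (λ m → 7 * (m * m)) (λ m → m * m * m * m + 6 * m) factVar-sum-closed n))
    where
    regroup : ∀ d n → 12 * (d + n * n * n * n) + (7 * ((n + n) * (n + n)) + (n * n * n * n + 6 * n))
                    ≡ 12 * d + 7 * ((n + n) * (n + n)) + (n * n * n * n + 6 * n) + 12 * (n * n * n * n)
    regroup = solve-∀

-- (k+1)² - 1 = k(k+2); the left side unfolds to k * 1 + k * (1 + k * 1).
pred-square : ∀ k → suc k ^ 2 ∸ 1 ≡ k * (k + 2)
pred-square = expand
  where
  expand : ∀ k → k * 1 + k * (1 + k * 1) ≡ k * (k + 2)
  expand = solve-∀

mean-excess : ∀ n → numMean n ≡ n * (n ^ 2 ∸ 1) + denMean n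
mean-excess zero    = refl
mean-excess (suc k) = cancel-via (suc k) (mean-gap (suc k)) (begin
  suc k * (suc k ^ 2 ∸ 1) + d + suc k ≡⟨ cong (λ z → suc k * z + d + suc k) (pred-square k) ⟩
  suc k * (k * (k + 2)) + d + suc k   ≡⟨ evaluate k d ⟩
  d + suc k * suc k * suc k           ∎)
  where
  d = denMean (suc k)
  evaluate : ∀ k d → suc k * (k * (k + 2)) + d + suc k ≡ d + suc k * suc k * suc k
  evaluate = solve-∀

var-excess : ∀ n → numVar n ≡ n ^ 2 * (n ^ 2 ∸ 1) + denVar n
var-excess zero    = refl
var-excess (suc k) = cancel-via (suc k * suc k) (var-gap (suc k)) (begin
  suc k ^ 2 * (suc k ^ 2 ∸ 1) + d + suc k * suc k ≡⟨ cong (λ z → suc k ^ 2 * z + d + suc k * suc k) (pred-square k) ⟩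
  suc k * (suc k * 1) * (k * (k + 2)) + d + suc k * suc k ≡⟨ evaluate k d ⟩
  d + suc k * suc k * suc k * suc k                ∎)
  where
  d = denVar (suc k)
  evaluate : ∀ k d → suc k * (suc k * 1) * (k * (k + 2)) + d + suc k * suc k ≡ d + suc k * suc k * suc k * suc k
  evaluate = solve-∀

-- With P · dppDen n = dppNum n, the mean and variance of P are those of
-- the numerator minus those of the denominator.
corollary7p8 : (n : ℕ) → 1 ≤ n → (P : Poly) → (P *ₚ dppDen n) ≈ₚ dppNum n →
    (6 * moment 1 P ≡ n * (n ^ 2 ∸ 1) * moment 0 P)
    × (12 * (moment 0 P * moment 2 P) ≡ 12 * (moment 1 P ^ 2) + n ^ 2 * (n ^ 2 ∸ 1) * (moment 0 P ^ 2))
corollary7p8 n _ P PD≈N =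
    mean-cancel (denMean n) (n * (n ^ 2 ∸ 1)) P D (mean-qfacts n (n +_)) meanPD
  , var-cancel (denVar n) (n ^ 2 * (n ^ 2 ∸ 1)) P D (var-qfacts n (n +_)) varPD
  where
  D = dppDen n
  N≈PD : dppNum n ≈ₚ (P *ₚ D)
  N≈PD k = sym (PD≈N k)
  instance
    D-nonzero : NonZero (m0 D)
    D-nonzero = qfacts-nonzero n (n +_)
  meanPD : Mean (n * (n ^ 2 ∸ 1) + denMean n) (P *ₚ D)
  meanPD = subst (λ a → Mean a (P *ₚ D)) (mean-excess n)
                 (mean-resp (numMean n) (dppNum n) (P *ₚ D) N≈PD (mean-qfacts n numIndex))
  varPD : Var (n ^ 2 * (n ^ 2 ∸ 1) + denVar n) (P *ₚ D)
  varPD = subst (λ v → Var v (P *ₚ D)) (var-excess n)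
                (var-resp (numVar n) (dppNum n) (P *ₚ D) N≈PD (var-qfacts n numIndex))
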